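{- Suppose each variable appears in at most $f$ clauses. Then there exists a single-pass streaming algorithm using $\tilde{O}(n)$ bits of space that yields a $2\sqrt{fn}$ approximation to $\textup{Min-SAT}$.
   Context: $\textup{Min-SAT}$: given $m$ clauses over Boolean variables $x_1,\dots,x_n$, each clause a disjunction of literals, find an assignment minimizing the number of satisfied clauses. $\mathrm{OPT}$ denotes this minimum. An $\alpha$ approximation outputs an assignment satisfying at most $\alpha\cdot\mathrm{OPT}$ clauses. The clauses arrive one at a time in a stream, and the algorithm makes a single pass. Space is measured in bits, and $\tilde{O}$ hides polylogarithmic factors. -}

module Defs where

open import Data.Nat using (ℕ; zero; suc; _+_; _*_; _^_; _≤_)
open import Data.Nat.Logarithm using (⌈log₂_⌉)
open import Data.Bool using (Bool; true; false; _∧_; _∨_; if_then_else_)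
open import Data.Fin using (Fin)
open import Data.Fin.Properties using () renaming (_≟_ to _≟ᶠ_)
open import Data.List using (List; []; _∷_; foldl; length)
open import Data.Bool.ListAction using (any)
open import Data.Product using (_×_; _,_; proj₁; Σ; ∃)
open import Relation.Nullary.Decidable using (⌊_⌋)
open import Relation.Binary.PropositionalEquality using (_≡_)

-- A literal over variables x_0..x_{n-1}: (variable index, polarity).
-- (i , true) is the positive literal x_i, (i , false) is ¬x_i.
Literal : ℕ → Set
Literal n = Fin n × Bool

Clause : ℕ → Set
Clause n = List (Literal n)

Assignment : ℕ → Set
Assignment n = Fin n → Bool

litVal : ∀ {n} → Assignment n → Literal n → Bool
litVal σ (i , true)  = σ i
litVal σ (i , false) = if σ i then false else true

satClause : ∀ {n} → Assignment n → Clause n → Bool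
satClause σ c = any (litVal σ) c

numSat : ∀ {n} → Assignment n → List (Clause n) → ℕ
numSat σ []       = 0
numSat σ (c ∷ cs) = (if satClause σ c then 1 else 0) + numSat σ cs

IsMinSatOpt : ∀ {n} → List (Clause n) → ℕ → Set
IsMinSatOpt {n} cs k =
  (∃ λ (σ : Assignment n) → numSat σ cs ≡ k) × (∀ (σ : Assignment n) → k ≤ numSat σ cs)

occursIn : ∀ {n} → Fin n → Clause n → Bool
occursIn i c = any (λ l → ⌊ i ≟ᶠ proj₁ l ⌋) c

occurrences : ∀ {n} → Fin n → List (Clause n) → ℕ
occurrences i []       = 0
occurrences i (c ∷ cs) = (if occursIn i c then 1 else 0) + occurrences i cs

FreqBounded : ∀ {n} → ℕ → List (Clause n) → Set
FreqBounded {n} f cs = ∀ (i : Fin n) → occurrences i cs ≤ f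

-- Its memory is a bit string; it processes clauses one at a time
-- (arbitrary computation per step, as is standard in the streaming model),
-- and at the end outputs an assignment computed from its memory.
record StreamAlg (n : ℕ) : Set where
  field
    init   : List Bool
    step   : List Bool → Clause n → List Bool
    output : List Bool → Assignment n

open StreamAlg public

run : ∀ {n} → StreamAlg n → List (Clause n) → List Bool
run A cs = foldl (step A) (init A) cs

-- Õ(n) bits: c · (n+1) · ⌈log₂(n+m+2)⌉^k for constants c, k
-- (m = number of clauses read so far)
softOBound : ℕ → ℕ → ℕ → ℕ → ℕ
softOBound c k n m = c * (suc n) * (⌈log₂ (n + m + 2) ⌉ ^ k)

-- Call a clause narrow if it has at most w = ⌊√(n f)⌋ variables. For every literal the
-- algorithm counts its occurrences in all clauses and in narrow clauses, and it sets each
-- variable to a polarity that occurs nowhere if there is one, and otherwise to the polarity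
-- with fewer narrow occurrences. Charging every satisfied narrow clause to one of its true
-- literals, the output satisfies at most as many narrow clauses as the summed narrow counts
-- of an optimal assignment s, and these are at most w · OPT because a narrow clause
-- satisfied by s contains at most w literals true under s. A wide clause has more than w
-- variables, so the frequency bound leaves at most n f / (w + 1) < w + 1 wide clauses.
-- Hence the output satisfies at most w + w · OPT ≤ 2 √(n f) · OPT clauses when OPT ≥ 1,
-- while for OPT = 0 the occurrence rule makes it satisfy none. The 4 n counters are kept
-- in self-delimiting binary, which takes O(n log (n + m)) bits.

module Submission where

open import Algebra.Properties.CommutativeSemigroup using (interchange)
open import Data.Bool using (Bool; true; false; T; not; _∧_; if_then_else_)
open import Data.Bool.Properties using () renaming (_≟_ to _≟ᵇ_)
open import Data.Fin using (Fin; combine; remQuot) renaming (zero to fzero; suc to fsuc)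
open import Data.Fin.Patterns using (0F; 1F; 2F; 3F)
open import Data.Fin.Properties using (remQuot-combine) renaming (_≟_ to _≟ᶠ_)
open import Data.List using (List; []; _∷_; _++_; [_]; foldl; length; allFin)
open import Data.List.Membership.Propositional using (_∈_; find; lose)
open import Data.List.Membership.Propositional.Properties using (∈-allFin)
import Data.List.Membership.DecPropositional as DecMembership
open import Data.List.Properties using (++-assoc; ++-identityʳ; length-++; length-tabulate)
open import Data.List.Relation.Unary.Any using (here; there)
open import Data.List.Relation.Unary.Any.Properties using (any⁺; any⁻)
open import Data.Nat
  using (ℕ; zero; suc; _+_; _*_; _^_; pred; _≤_; _<_; _≤ᵇ_; z≤n; s≤s; s≤s⁻¹; >-nonZero)
open import Data.Nat.Binary.Base as ℕᵇ using (ℕᵇ; 2[1+_]; 1+[2_]; size; toℕ; fromℕ)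
open import Data.Nat.Binary.Properties using (toℕ-fromℕ)
open import Data.Nat.Logarithm using (⌈log₂_⌉; ⌈log₂⌉-mono-≤; ⌈log₂2^n⌉≡n)
open import Data.Nat.Properties
open import Data.Nat.Tactic.RingSolver using (solve-∀)
open import Data.Product using (Σ; ∃; _×_; _,_; proj₁; proj₂; map₁; uncurry)
open import Data.Product.Properties using (≡-dec)
open import Data.Unit using (tt)
open import Data.Vec using (Vec; lookup; tabulate) renaming ([] to []ᵛ; _∷_ to _∷ᵛ_)
open import Data.Vec.Properties using (lookup∘tabulate; tabulate-cong)
open import Function using (_∘_; id)
open import Relation.Binary.PropositionalEquality
  using (_≡_; refl; sym; trans; cong; cong₂; subst; module ≡-Reasoning)
open import Relation.Nullary using (yes; no)
open import Relation.Nullary.Decidable using (⌊_⌋; toWitness; fromWitness)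

open import Defs

infix 5 ∑
∑ : {A : Set} → List A → (A → ℕ) → ℕ
∑ []       g = 0
∑ (x ∷ xs) g = g x + ∑ xs g

syntax ∑ xs (λ x → e) = ∑[ x ∈ xs ] e

module _ {A : Set} where

  ∑-mono-≤ : ∀ (xs : List A) {g h : A → ℕ} → (∀ x → g x ≤ h x) → ∑ xs g ≤ ∑ xs h
  ∑-mono-≤ []       g≤h = z≤n
  ∑-mono-≤ (x ∷ xs) g≤h = +-mono-≤ (g≤h x) (∑-mono-≤ xs g≤h)

  ∑-cong : ∀ (xs : List A) {g h : A → ℕ} → (∀ x → g x ≡ h x) → ∑ xs g ≡ ∑ xs h
  ∑-cong []       g≡h = refl
  ∑-cong (x ∷ xs) g≡h = cong₂ _+_ (g≡h x) (∑-cong xs g≡h)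

  ∑-++ : ∀ (xs ys : List A) (g : A → ℕ) → ∑ (xs ++ ys) g ≡ ∑ xs g + ∑ ys g
  ∑-++ []       ys g = refl
  ∑-++ (x ∷ xs) ys g = trans (cong (g x +_) (∑-++ xs ys g)) (sym (+-assoc (g x) _ _))

  ∑-distrib-+ : ∀ (xs : List A) (g h : A → ℕ) → ∑[ x ∈ xs ] (g x + h x) ≡ ∑ xs g + ∑ xs h
  ∑-distrib-+ []       g h = refl
  ∑-distrib-+ (x ∷ xs) g h = trans (cong (g x + h x +_) (∑-distrib-+ xs g h))
                                   (interchange +-commutativeSemigroup (g x) (h x) (∑ xs g) (∑ xs h))

  *-distribˡ-∑ : ∀ k (xs : List A) (g : A → ℕ) → k * ∑ xs g ≡ ∑[ x ∈ xs ] (k * g x)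
  *-distribˡ-∑ k []       g = *-zeroʳ k
  *-distribˡ-∑ k (x ∷ xs) g = trans (*-distribˡ-+ k (g x) (∑ xs g))
                                    (cong (k * g x +_) (*-distribˡ-∑ k xs g))

  ∑-zero : ∀ (xs : List A) → ∑[ x ∈ xs ] 0 ≡ 0
  ∑-zero []       = refl
  ∑-zero (x ∷ xs) = ∑-zero xs

  ∑-const : ∀ (xs : List A) k → ∑[ x ∈ xs ] k ≡ length xs * k
  ∑-const []       k = refl
  ∑-const (x ∷ xs) k = cong (k +_) (∑-const xs k)

  ∈⇒≤∑ : ∀ {xs : List A} {x} (g : A → ℕ) → x ∈ xs → g x ≤ ∑ xs g
  ∈⇒≤∑ g (here refl) = m≤m+n _ _
  ∈⇒≤∑ {y ∷ _} g (there x∈xs) = ≤-trans (∈⇒≤∑ g x∈xs) (m≤n+m _ (g y))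

∑-comm : ∀ {A B : Set} (xs : List A) (ys : List B) (g : A → B → ℕ) →
         ∑[ x ∈ xs ] ∑[ y ∈ ys ] g x y ≡ ∑[ y ∈ ys ] ∑[ x ∈ xs ] g x y
∑-comm []       ys g = sym (∑-zero ys)
∑-comm (x ∷ xs) ys g = trans (cong (∑ ys (g x) +_) (∑-comm xs ys g))
                             (sym (∑-distrib-+ ys (g x) (λ y → ∑[ x ∈ xs ] g x y)))

𝟙 : Bool → ℕ
𝟙 b = if b then 1 else 0

𝟙≤1 : ∀ b → 𝟙 b ≤ 1
𝟙≤1 false = z≤n
𝟙≤1 true  = ≤-refl

𝟙-mono : ∀ {a b} → (T a → T b) → 𝟙 a ≤ 𝟙 b
𝟙-mono {false} a⇒b = z≤n
𝟙-mono {true} {true}  a⇒b = ≤-refl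
𝟙-mono {true} {false} a⇒b with () ← a⇒b tt

𝟙-∧≤ : ∀ a b → 𝟙 (a ∧ b) ≤ 𝟙 b
𝟙-∧≤ false b = z≤n
𝟙-∧≤ true  b = ≤-refl

𝟙-∧-monoʳ : ∀ a {b b′} → (T b → T b′) → 𝟙 (a ∧ b) ≤ 𝟙 (a ∧ b′)
𝟙-∧-monoʳ false b⇒b′ = z≤n
𝟙-∧-monoʳ true  b⇒b′ = 𝟙-mono b⇒b′

codeᵇ : ℕᵇ → List Bool
codeᵇ ℕᵇ.zero   = false ∷ []
codeᵇ 2[1+ x ] = true ∷ false ∷ codeᵇ x
codeᵇ 1+[2 x ] = true ∷ true ∷ codeᵇ x

decodeᵇ : List Bool → ℕᵇ × List Bool
decodeᵇ (false ∷ bs)        = ℕᵇ.zero , bs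
decodeᵇ (true ∷ false ∷ bs) = map₁ 2[1+_] (decodeᵇ bs)
decodeᵇ (true ∷ true ∷ bs)  = map₁ 1+[2_] (decodeᵇ bs)
decodeᵇ _                   = ℕᵇ.zero , []

decodeᵇ-codeᵇ : ∀ x bs → decodeᵇ (codeᵇ x ++ bs) ≡ (x , bs)
decodeᵇ-codeᵇ ℕᵇ.zero   bs = refl
decodeᵇ-codeᵇ 2[1+ x ] bs rewrite decodeᵇ-codeᵇ x bs = refl
decodeᵇ-codeᵇ 1+[2 x ] bs rewrite decodeᵇ-codeᵇ x bs = refl

length-codeᵇ : ∀ x → length (codeᵇ x) ≡ suc (2 * size x)
length-codeᵇ ℕᵇ.zero   = refl
length-codeᵇ 2[1+ x ] = trans (cong (2 +_) (length-codeᵇ x)) (cong suc (sym (*-suc 2 (size x))))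
length-codeᵇ 1+[2 x ] = trans (cong (2 +_) (length-codeᵇ x)) (cong suc (sym (*-suc 2 (size x))))

2^size≤1+toℕ : ∀ x → 2 ^ size x ≤ suc (toℕ x)
2^size≤1+toℕ ℕᵇ.zero   = ≤-refl
2^size≤1+toℕ 2[1+ x ] = ≤-trans (*-monoʳ-≤ 2 (2^size≤1+toℕ x)) (n≤1+n _)
2^size≤1+toℕ 1+[2 x ] = ≤-trans (*-monoʳ-≤ 2 (2^size≤1+toℕ x)) (≤-reflexive (*-suc 2 (toℕ x)))

size-fromℕ≤⌈log₂⌉ : ∀ x → size (fromℕ x) ≤ ⌈log₂ suc x ⌉
size-fromℕ≤⌈log₂⌉ x = begin
  size (fromℕ x)                   ≡⟨ ⌈log₂2^n⌉≡n (size (fromℕ x)) ⟨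
  ⌈log₂ 2 ^ size (fromℕ x) ⌉       ≤⟨ ⌈log₂⌉-mono-≤ (2^size≤1+toℕ (fromℕ x)) ⟩
  ⌈log₂ suc (toℕ (fromℕ x)) ⌉      ≡⟨ cong (λ y → ⌈log₂ suc y ⌉) (toℕ-fromℕ x) ⟩
  ⌈log₂ suc x ⌉                    ∎
  where open ≤-Reasoning

encodeℕ : ℕ → List Bool
encodeℕ x = codeᵇ (fromℕ x)

decodeℕ : List Bool → ℕ × List Bool
decodeℕ bs = map₁ toℕ (decodeᵇ bs)

decodeℕ-encodeℕ : ∀ x bs → decodeℕ (encodeℕ x ++ bs) ≡ (x , bs)
decodeℕ-encodeℕ x bs rewrite decodeᵇ-codeᵇ (fromℕ x) bs | toℕ-fromℕ x = refl

length-encodeℕ : ∀ {m} x → x ≤ m → length (encodeℕ x) ≤ suc (2 * ⌈log₂ suc m ⌉)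
length-encodeℕ {m} x x≤m = begin
  length (encodeℕ x)               ≡⟨ length-codeᵇ (fromℕ x) ⟩
  suc (2 * size (fromℕ x))         ≤⟨ s≤s (*-monoʳ-≤ 2 (size-fromℕ≤⌈log₂⌉ x)) ⟩
  suc (2 * ⌈log₂ suc x ⌉)          ≤⟨ s≤s (*-monoʳ-≤ 2 (⌈log₂⌉-mono-≤ (s≤s x≤m))) ⟩
  suc (2 * ⌈log₂ suc m ⌉)          ∎
  where open ≤-Reasoning

encode : ∀ {k} → Vec ℕ k → List Bool
encode []ᵛ       = []
encode (x ∷ᵛ xs) = encodeℕ x ++ encode xs

decode : ∀ k → List Bool → Vec ℕ k × List Bool
decode zero    bs = []ᵛ , bs
decode (suc k) bs = map₁ (proj₁ (decodeℕ bs) ∷ᵛ_) (decode k (proj₂ (decodeℕ bs)))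

decode-encode : ∀ {k} (xs : Vec ℕ k) bs → decode k (encode xs ++ bs) ≡ (xs , bs)
decode-encode []ᵛ       bs = refl
decode-encode {suc k} (x ∷ᵛ xs) bs = begin
  decode (suc k) ((encodeℕ x ++ encode xs) ++ bs)
    ≡⟨ cong (decode (suc k)) (++-assoc (encodeℕ x) (encode xs) bs) ⟩
  decode (suc k) (encodeℕ x ++ (encode xs ++ bs))
    ≡⟨ cong (λ d → map₁ (proj₁ d ∷ᵛ_) (decode k (proj₂ d))) (decodeℕ-encodeℕ x (encode xs ++ bs)) ⟩
  map₁ (x ∷ᵛ_) (decode k (encode xs ++ bs))
    ≡⟨ cong (map₁ (x ∷ᵛ_)) (decode-encode xs bs) ⟩
  (x ∷ᵛ xs , bs) ∎
  where open ≡-Reasoning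

length-encode : ∀ {k m} (xs : Vec ℕ k) → (∀ j → lookup xs j ≤ m) →
                length (encode xs) ≤ k * suc (2 * ⌈log₂ suc m ⌉)
length-encode []ᵛ       xs≤m = z≤n
length-encode {suc k} {m} (x ∷ᵛ xs) xs≤m = begin
  length (encodeℕ x ++ encode xs)  ≡⟨ length-++ (encodeℕ x) ⟩
  length (encodeℕ x) + length (encode xs)
    ≤⟨ +-mono-≤ (length-encodeℕ x (xs≤m fzero)) (length-encode xs (xs≤m ∘ fsuc)) ⟩
  suc k * suc (2 * ⌈log₂ suc m ⌉)  ∎
  where open ≤-Reasoning

module Counting {n k : ℕ} (count : Clause n → Fin k → ℕ) (choose : Vec ℕ k → Assignment n) where

  counters : List (Clause n) → Vec ℕ k
  counters cs = tabulate (λ j → ∑[ c ∈ cs ] count c j)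

  load : List Bool → Vec ℕ k
  load mem = proj₁ (decode k mem)

  algorithm : StreamAlg n
  algorithm = record
    { init   = encode (counters [])
    ; step   = λ mem c → encode (tabulate (λ j → lookup (load mem) j + count c j))
    ; output = choose ∘ load
    }

  load-encode : ∀ xs → load (encode xs) ≡ xs
  load-encode xs = cong proj₁ (begin
    decode k (encode xs)        ≡⟨ cong (decode k) (++-identityʳ (encode xs)) ⟨
    decode k (encode xs ++ [])  ≡⟨ decode-encode xs [] ⟩
    (xs , [])                   ∎)
    where open ≡-Reasoning

  lookup-counters : ∀ cs j → lookup (counters cs) j ≡ ∑[ c ∈ cs ] count c j
  lookup-counters cs j = lookup∘tabulate (λ j → ∑[ c ∈ cs ] count c j) j

  step-counters : ∀ cs c → step algorithm (encode (counters cs)) c ≡ encode (counters (cs ++ [ c ]))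
  step-counters cs c = cong encode (tabulate-cong λ j → begin
    lookup (load (encode (counters cs))) j + count c j
      ≡⟨ cong (λ xs → lookup xs j + count c j) (load-encode (counters cs)) ⟩
    lookup (counters cs) j + count c j
      ≡⟨ cong₂ _+_ (lookup-counters cs j) (sym (+-identityʳ (count c j))) ⟩
    (∑[ d ∈ cs ] count d j) + (count c j + 0)
      ≡⟨ ∑-++ cs [ c ] (λ d → count d j) ⟨
    ∑[ d ∈ cs ++ [ c ] ] count d j ∎)
    where open ≡-Reasoning

  run-from : ∀ ps cs → foldl (step algorithm) (encode (counters ps)) cs ≡ encode (counters (ps ++ cs))
  run-from ps []       = cong (encode ∘ counters) (sym (++-identityʳ ps))
  run-from ps (c ∷ cs) = begin
    foldl (step algorithm) (step algorithm (encode (counters ps)) c) cs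
      ≡⟨ cong (λ mem → foldl (step algorithm) mem cs) (step-counters ps c) ⟩
    foldl (step algorithm) (encode (counters (ps ++ [ c ]))) cs
      ≡⟨ run-from (ps ++ [ c ]) cs ⟩
    encode (counters ((ps ++ [ c ]) ++ cs))
      ≡⟨ cong (encode ∘ counters) (++-assoc ps [ c ] cs) ⟩
    encode (counters (ps ++ c ∷ cs)) ∎
    where open ≡-Reasoning

  output-run : ∀ cs → output algorithm (run algorithm cs) ≡ choose (counters cs)
  output-run cs = cong choose (trans (cong load (run-from [] cs)) (load-encode (counters cs)))

  length-run : (∀ c j → count c j ≤ 1) →
               ∀ cs → length (run algorithm cs) ≤ k * suc (2 * ⌈log₂ suc (length cs) ⌉)
  length-run count≤1 cs = begin
    length (run algorithm cs)        ≡⟨ cong length (run-from [] cs) ⟩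
    length (encode (counters cs))    ≤⟨ length-encode (counters cs) counter≤length ⟩
    k * suc (2 * ⌈log₂ suc (length cs) ⌉) ∎
    where
    open ≤-Reasoning
    counter≤length : ∀ j → lookup (counters cs) j ≤ length cs
    counter≤length j = begin
      lookup (counters cs) j  ≡⟨ lookup-counters cs j ⟩
      ∑[ c ∈ cs ] count c j   ≤⟨ ∑-mono-≤ cs (λ c → count≤1 c j) ⟩
      ∑[ c ∈ cs ] 1           ≡⟨ ∑-const cs 1 ⟩
      length cs * 1           ≡⟨ *-identityʳ (length cs) ⟩
      length cs               ∎

module _ {n : ℕ} where
  open DecMembership (≡-dec (_≟ᶠ_ {n}) _≟ᵇ_) using (_∈?_)

  contains : Clause n → Literal n → Bool
  contains c ℓ = ⌊ ℓ ∈? c ⌋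

  contains⇒∈ : ∀ {c ℓ} → T (contains c ℓ) → ℓ ∈ c
  contains⇒∈ = toWitness

  ∈⇒contains : ∀ {c ℓ} → ℓ ∈ c → T (contains c ℓ)
  ∈⇒contains = fromWitness

  litVal⇒≡ : ∀ (σ : Assignment n) {i} b → T (litVal σ (i , b)) → σ i ≡ b
  litVal⇒≡ σ {i} true  holds with σ i
  litVal⇒≡ σ true  holds | true = refl
  litVal⇒≡ σ true  ()    | false
  litVal⇒≡ σ {i} false holds with σ i
  litVal⇒≡ σ false ()    | true
  litVal⇒≡ σ false holds | false = refl

  litVal-self : ∀ (σ : Assignment n) i → T (litVal σ (i , σ i))
  litVal-self σ i with σ i in σi≡
  ... | true  = subst T (sym σi≡) tt
  ... | false rewrite σi≡ = tt

  satisfied⇒contains : ∀ (σ : Assignment n) c → T (satClause σ c) → ∃ λ i → (i , σ i) ∈ c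
  satisfied⇒contains σ c sat with find (any⁻ (litVal σ) c sat)
  ... | (i , b) , ℓ∈c , holds = i , subst (λ b → (i , b) ∈ c) (sym (litVal⇒≡ σ b holds)) ℓ∈c

  contains⇒satisfied : ∀ (σ : Assignment n) {c} i → (i , σ i) ∈ c → T (satClause σ c)
  contains⇒satisfied σ i ℓ∈c = any⁺ (litVal σ) (lose ℓ∈c (litVal-self σ i))

  contains⇒occursIn : ∀ {c : Clause n} {i b} → (i , b) ∈ c → T (occursIn i c)
  contains⇒occursIn {i = i} ℓ∈c =
    any⁺ (λ l → ⌊ i ≟ᶠ proj₁ l ⌋) (lose ℓ∈c (fromWitness {a? = i ≟ᶠ i} refl))

numSat≡∑ : ∀ {n} (σ : Assignment n) cs → numSat σ cs ≡ ∑[ c ∈ cs ] 𝟙 (satClause σ c)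
numSat≡∑ σ []       = refl
numSat≡∑ σ (c ∷ cs) = cong (𝟙 (satClause σ c) +_) (numSat≡∑ σ cs)

occurrences≡∑ : ∀ {n} (i : Fin n) cs → occurrences i cs ≡ ∑[ c ∈ cs ] 𝟙 (occursIn i c)
occurrences≡∑ i []       = refl
occurrences≡∑ i (c ∷ cs) = cong (𝟙 (occursIn i c) +_) (occurrences≡∑ i cs)

-- The rank of a literal with t occurrences, k of them in narrow clauses: absent literals
-- come first, the others are ordered by k.
rank : ℕ → ℕ → ℕ
rank zero    _ = 0
rank (suc _) k = suc k

rank≡0⇒≡0 : ∀ t {k} → rank t k ≡ 0 → t ≡ 0
rank≡0⇒≡0 zero refl = refl

pred-rank : ∀ {t k} → k ≤ t → pred (rank t k) ≡ k
pred-rank {zero}  z≤n = refl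
pred-rank {suc t} _   = refl

minimiser : (Bool → ℕ) → Bool
minimiser r = r true ≤ᵇ r false

minimiser-≤ : ∀ (r : Bool → ℕ) b → r (minimiser r) ≤ r b
minimiser-≤ r b with r true ≤ᵇ r false in r⊤≤r⊥ | b
... | true  | true  = ≤-refl
... | true  | false = ≤ᵇ⇒≤ (r true) (r false) (subst T (sym r⊤≤r⊥) tt)
... | false | true  = <⇒≤ (≰⇒> (λ r⊤≤r⊥′ → subst T r⊤≤r⊥ (≤⇒≤ᵇ r⊤≤r⊥′)))
... | false | false = ≤-refl

module Threshold {n : ℕ} (w : ℕ) where

  width : Clause n → ℕ
  width c = ∑[ i ∈ allFin n ] 𝟙 (occursIn i c)

  narrow : Clause n → Bool
  narrow c = width c ≤ᵇ w

  wide : List (Clause n) → ℕ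
  wide cs = ∑[ c ∈ cs ] 𝟙 (not (narrow c))

  occ : Literal n → List (Clause n) → ℕ
  occ ℓ cs = ∑[ c ∈ cs ] 𝟙 (contains c ℓ)

  narrowOcc : Literal n → List (Clause n) → ℕ
  narrowOcc ℓ cs = ∑[ c ∈ cs ] 𝟙 (narrow c ∧ contains c ℓ)

  sat≤∑contains : ∀ (σ : Assignment n) c →
                  𝟙 (satClause σ c) ≤ ∑[ i ∈ allFin n ] 𝟙 (contains c (i , σ i))
  sat≤∑contains σ c with satClause σ c in sat
  ... | false = z≤n
  ... | true  with i , ℓ∈c ← satisfied⇒contains σ c (subst T (sym sat) tt) =
    ≤-trans (𝟙-mono (λ _ → ∈⇒contains ℓ∈c)) (∈⇒≤∑ (λ i → 𝟙 (contains c (i , σ i))) (∈-allFin i))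

  sat≤wide+narrow : ∀ (σ : Assignment n) c →
    𝟙 (satClause σ c) ≤ 𝟙 (not (narrow c)) + (∑[ i ∈ allFin n ] 𝟙 (narrow c ∧ contains c (i , σ i)))
  sat≤wide+narrow σ c with narrow c
  ... | true  = sat≤∑contains σ c
  ... | false = m≤n⇒m≤n+o _ (𝟙≤1 (satClause σ c))

  narrowWidth≤w : ∀ c → ∑[ i ∈ allFin n ] 𝟙 (narrow c ∧ occursIn i c) ≤ w
  narrowWidth≤w c with narrow c in isNarrow
  ... | true  = ≤ᵇ⇒≤ (width c) w (subst T (sym isNarrow) tt)
  ... | false = ≤-trans (≤-reflexive (∑-zero (allFin n))) z≤n

  narrowContains≤w*sat : ∀ (σ : Assignment n) c →
    ∑[ i ∈ allFin n ] 𝟙 (narrow c ∧ contains c (i , σ i)) ≤ w * 𝟙 (satClause σ c)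
  narrowContains≤w*sat σ c with satClause σ c in sat
  ... | true  = begin
    ∑[ i ∈ allFin n ] 𝟙 (narrow c ∧ contains c (i , σ i))
      ≤⟨ ∑-mono-≤ (allFin n) (λ i → 𝟙-∧-monoʳ (narrow c) (contains⇒occursIn ∘ contains⇒∈)) ⟩
    ∑[ i ∈ allFin n ] 𝟙 (narrow c ∧ occursIn i c)
      ≤⟨ narrowWidth≤w c ⟩
    w ≡⟨ *-identityʳ w ⟨
    w * 1 ∎
    where open ≤-Reasoning
  ... | false = begin
    ∑[ i ∈ allFin n ] 𝟙 (narrow c ∧ contains c (i , σ i))
      ≤⟨ ∑-mono-≤ (allFin n) (λ i → ≤-trans (𝟙-∧≤ (narrow c) _)
                    (𝟙-mono (subst T sat ∘ contains⇒satisfied σ i ∘ contains⇒∈))) ⟩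
    ∑[ i ∈ allFin n ] 0 ≡⟨ ∑-zero (allFin n) ⟩
    0 ≡⟨ *-zeroʳ w ⟨
    w * 0 ∎
    where open ≤-Reasoning

  wide⇒wider : ∀ c → suc w * 𝟙 (not (narrow c)) ≤ width c
  wide⇒wider c with narrow c in isNarrow
  ... | true  = ≤-trans (≤-reflexive (*-zeroʳ (suc w))) z≤n
  ... | false = ≤-trans (≤-reflexive (*-identityʳ (suc w)))
                        (≰⇒> (λ width≤w → subst T isNarrow (≤⇒≤ᵇ width≤w)))

  numSat≤∑occ : ∀ (σ : Assignment n) cs → numSat σ cs ≤ ∑[ i ∈ allFin n ] occ (i , σ i) cs
  numSat≤∑occ σ cs = begin
    numSat σ cs                                                 ≡⟨ numSat≡∑ σ cs ⟩
    ∑[ c ∈ cs ] 𝟙 (satClause σ c)                               ≤⟨ ∑-mono-≤ cs (sat≤∑contains σ) ⟩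
    ∑[ c ∈ cs ] ∑[ i ∈ allFin n ] 𝟙 (contains c (i , σ i))      ≡⟨ ∑-comm cs (allFin n) _ ⟩
    ∑[ i ∈ allFin n ] occ (i , σ i) cs                          ∎
    where open ≤-Reasoning

  numSat≤wide+∑narrowOcc : ∀ (σ : Assignment n) cs →
                           numSat σ cs ≤ wide cs + (∑[ i ∈ allFin n ] narrowOcc (i , σ i) cs)
  numSat≤wide+∑narrowOcc σ cs = begin
    numSat σ cs                    ≡⟨ numSat≡∑ σ cs ⟩
    ∑[ c ∈ cs ] 𝟙 (satClause σ c)  ≤⟨ ∑-mono-≤ cs (sat≤wide+narrow σ) ⟩
    ∑[ c ∈ cs ] (𝟙 (not (narrow c)) + (∑[ i ∈ allFin n ] 𝟙 (narrow c ∧ contains c (i , σ i))))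
      ≡⟨ ∑-distrib-+ cs _ _ ⟩
    wide cs + (∑[ c ∈ cs ] ∑[ i ∈ allFin n ] 𝟙 (narrow c ∧ contains c (i , σ i)))
      ≡⟨ cong (wide cs +_) (∑-comm cs (allFin n) _) ⟩
    wide cs + (∑[ i ∈ allFin n ] narrowOcc (i , σ i) cs) ∎
    where open ≤-Reasoning

  ∑narrowOcc≤w*numSat : ∀ (σ : Assignment n) cs →
                        ∑[ i ∈ allFin n ] narrowOcc (i , σ i) cs ≤ w * numSat σ cs
  ∑narrowOcc≤w*numSat σ cs = begin
    ∑[ i ∈ allFin n ] narrowOcc (i , σ i) cs                          ≡⟨ ∑-comm (allFin n) cs _ ⟩
    ∑[ c ∈ cs ] ∑[ i ∈ allFin n ] 𝟙 (narrow c ∧ contains c (i , σ i))  ≤⟨ ∑-mono-≤ cs (narrowContains≤w*sat σ) ⟩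
    ∑[ c ∈ cs ] w * 𝟙 (satClause σ c)                                 ≡⟨ *-distribˡ-∑ w cs _ ⟨
    w * (∑[ c ∈ cs ] 𝟙 (satClause σ c))                               ≡⟨ cong (w *_) (numSat≡∑ σ cs) ⟨
    w * numSat σ cs                                                   ∎
    where open ≤-Reasoning

  [1+w]*wide≤n*f : ∀ {f} cs → FreqBounded f cs → suc w * wide cs ≤ n * f
  [1+w]*wide≤n*f {f} cs freq = begin
    suc w * wide cs                                     ≡⟨ *-distribˡ-∑ (suc w) cs _ ⟩
    ∑[ c ∈ cs ] suc w * 𝟙 (not (narrow c))              ≤⟨ ∑-mono-≤ cs wide⇒wider ⟩
    ∑[ c ∈ cs ] width c                                 ≡⟨ ∑-comm cs (allFin n) _ ⟩
    ∑[ i ∈ allFin n ] ∑[ c ∈ cs ] 𝟙 (occursIn i c)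
      ≤⟨ ∑-mono-≤ (allFin n) (λ i → ≤-trans (≤-reflexive (sym (occurrences≡∑ i cs))) (freq i)) ⟩
    ∑[ i ∈ allFin n ] f                                 ≡⟨ ∑-const (allFin n) f ⟩
    length (allFin n) * f                               ≡⟨ cong (_* f) (length-tabulate {n = n} id) ⟩
    n * f                                               ∎
    where open ≤-Reasoning

  occ≤numSat : ∀ (σ : Assignment n) cs i → occ (i , σ i) cs ≤ numSat σ cs
  occ≤numSat σ cs i = ≤-trans (∑-mono-≤ cs (λ c → 𝟙-mono (contains⇒satisfied σ i ∘ contains⇒∈)))
                              (≤-reflexive (sym (numSat≡∑ σ cs)))

  litRank : Literal n → List (Clause n) → ℕ
  litRank ℓ cs = rank (occ ℓ cs) (narrowOcc ℓ cs)

  pred-litRank : ∀ ℓ cs → pred (litRank ℓ cs) ≡ narrowOcc ℓ cs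
  pred-litRank ℓ cs = pred-rank (∑-mono-≤ cs (λ c → 𝟙-∧≤ (narrow c) (contains c ℓ)))

  module RankMinimising (cs : List (Clause n)) (τ : Assignment n)
                        (τ-min : ∀ i b → litRank (i , τ i) cs ≤ litRank (i , b) cs) where

    narrowOcc-min : ∀ i b → narrowOcc (i , τ i) cs ≤ narrowOcc (i , b) cs
    narrowOcc-min i b = begin
      narrowOcc (i , τ i) cs         ≡⟨ pred-litRank (i , τ i) cs ⟨
      pred (litRank (i , τ i) cs)    ≤⟨ pred-mono-≤ (τ-min i b) ⟩
      pred (litRank (i , b) cs)      ≡⟨ pred-litRank (i , b) cs ⟩
      narrowOcc (i , b) cs           ∎
      where open ≤-Reasoning

    occ-min : ∀ i b → occ (i , b) cs ≡ 0 → occ (i , τ i) cs ≡ 0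
    occ-min i b absent = rank≡0⇒≡0 (occ (i , τ i) cs)
      (n≤0⇒n≡0 (≤-trans (τ-min i b) (≤-reflexive (cong (λ t → rank t (narrowOcc (i , b) cs)) absent))))

    numSat≤wide+w*numSat : ∀ s → numSat τ cs ≤ wide cs + w * numSat s cs
    numSat≤wide+w*numSat s = begin
      numSat τ cs                                           ≤⟨ numSat≤wide+∑narrowOcc τ cs ⟩
      wide cs + (∑[ i ∈ allFin n ] narrowOcc (i , τ i) cs)
        ≤⟨ +-monoʳ-≤ (wide cs) (∑-mono-≤ (allFin n) (λ i → narrowOcc-min i (s i))) ⟩
      wide cs + (∑[ i ∈ allFin n ] narrowOcc (i , s i) cs)  ≤⟨ +-monoʳ-≤ (wide cs) (∑narrowOcc≤w*numSat s cs) ⟩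
      wide cs + w * numSat s cs                             ∎
      where open ≤-Reasoning

    numSat≡0 : ∀ s → numSat s cs ≡ 0 → numSat τ cs ≡ 0
    numSat≡0 s unsat = n≤0⇒n≡0 (begin
      numSat τ cs                          ≤⟨ numSat≤∑occ τ cs ⟩
      ∑[ i ∈ allFin n ] occ (i , τ i) cs   ≡⟨ ∑-cong (allFin n) (λ i → occ-min i (s i) (s-absent i)) ⟩
      ∑[ i ∈ allFin n ] 0                  ≡⟨ ∑-zero (allFin n) ⟩
      0                                    ∎)
      where
      open ≤-Reasoning
      s-absent : ∀ i → occ (i , s i) cs ≡ 0
      s-absent i = n≤0⇒n≡0 (≤-trans (occ≤numSat s cs i) (≤-reflexive unsat))

⌊√_⌋ : ℕ → ℕ
⌊√ zero ⌋  = 0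
⌊√ suc x ⌋ with suc ⌊√ x ⌋ * suc ⌊√ x ⌋ ≤? suc x
... | yes _ = suc ⌊√ x ⌋
... | no _  = ⌊√ x ⌋

⌊√⌋-spec : ∀ x → ⌊√ x ⌋ * ⌊√ x ⌋ ≤ x × x < suc ⌊√ x ⌋ * suc ⌊√ x ⌋
⌊√⌋-spec zero = z≤n , s≤s z≤n
⌊√⌋-spec (suc x) with ⌊√⌋-spec x | suc ⌊√ x ⌋ * suc ⌊√ x ⌋ ≤? suc x
... | _ , x<[r+1]² | yes [r+1]²≤x+1 =
  [r+1]²≤x+1 , ≤-<-trans x<[r+1]² (*-mono-< (n<1+n (suc ⌊√ x ⌋)) (n<1+n (suc ⌊√ x ⌋)))
... | r²≤x , _     | no [r+1]²≰x+1  = m≤n⇒m≤1+n r²≤x , ≰⇒> [r+1]²≰x+1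

-- The bounds on W and N force W ≤ w, hence a ≤ 2 w o.
square-bound : ∀ {a W w o N} → a ≤ W + w * o → suc w * W ≤ N →
               w * w ≤ N → N < suc w * suc w → 1 ≤ o → a * a ≤ 4 * N * (o * o)
square-bound {a} {W} {w} {o} {N} a≤ [w+1]W≤N w²≤N N<[w+1]² 1≤o = begin
  a * a                               ≤⟨ *-mono-≤ a≤2wo a≤2wo ⟩
  (w * o + w * o) * (w * o + w * o)   ≡⟨ square-double w o ⟩
  4 * (w * w) * (o * o)               ≤⟨ *-monoˡ-≤ (o * o) (*-monoʳ-≤ 4 w²≤N) ⟩
  4 * N * (o * o)                     ∎
  where
  open ≤-Reasoning
  square-double : ∀ w o → (w * o + w * o) * (w * o + w * o) ≡ 4 * (w * w) * (o * o)
  square-double = solve-∀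
  W≤w : W ≤ w
  W≤w = s≤s⁻¹ (*-cancelˡ-< (suc w) W (suc w) (≤-<-trans [w+1]W≤N N<[w+1]²))
  a≤2wo : a ≤ w * o + w * o
  a≤2wo = ≤-trans a≤ (+-monoˡ-≤ (w * o) (≤-trans W≤w (m≤m*n w o {{>-nonZero 1≤o}})))

space-bound : ∀ n m → n * 4 * suc (2 * ⌈log₂ suc m ⌉) ≤ softOBound 12 1 n m
space-bound n m = begin
  n * 4 * suc (2 * ⌈log₂ suc m ⌉)  ≤⟨ *-monoʳ-≤ (n * 4) (+-mono-≤ 1≤L (*-monoʳ-≤ 2 log≤L)) ⟩
  n * 4 * (L + 2 * L)              ≡⟨ rearrange n L ⟩
  12 * n * L                       ≤⟨ *-monoˡ-≤ L (*-monoʳ-≤ 12 (n≤1+n n)) ⟩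
  12 * suc n * L                   ≡⟨ cong (12 * suc n *_) (^-identityʳ L) ⟨
  12 * suc n * L ^ 1               ∎
  where
  open ≤-Reasoning
  L : ℕ
  L = ⌈log₂ (n + m + 2) ⌉
  log≤L : ⌈log₂ suc m ⌉ ≤ L
  log≤L = ⌈log₂⌉-mono-≤ (begin
    suc m          ≤⟨ s≤s (m≤n+m m n) ⟩
    suc (n + m)    ≤⟨ n≤1+n _ ⟩
    2 + (n + m)    ≡⟨ +-comm 2 (n + m) ⟩
    n + m + 2      ∎)
  1≤L : 1 ≤ L
  1≤L = ⌈log₂⌉-mono-≤ {2} (m≤n+m 2 (n + m))
  rearrange : ∀ n L → n * 4 * (L + 2 * L) ≡ 12 * n * L
  rearrange = solve-∀

module MinSatAlgorithm (n f : ℕ) where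

  w : ℕ
  w = ⌊√ (n * f) ⌋

  open Threshold {n} w

  tally : Clause n → Fin n → Fin 4 → ℕ
  tally c i 0F = 𝟙 (contains c (i , true))
  tally c i 1F = 𝟙 (narrow c ∧ contains c (i , true))
  tally c i 2F = 𝟙 (contains c (i , false))
  tally c i 3F = 𝟙 (narrow c ∧ contains c (i , false))

  tally≤1 : ∀ c i κ → tally c i κ ≤ 1
  tally≤1 c i 0F = 𝟙≤1 _
  tally≤1 c i 1F = 𝟙≤1 _
  tally≤1 c i 2F = 𝟙≤1 _
  tally≤1 c i 3F = 𝟙≤1 _

  choose : Vec ℕ (n * 4) → Assignment n
  choose v i = rank (at 0F) (at 1F) ≤ᵇ rank (at 2F) (at 3F)
    where
    at : Fin 4 → ℕ
    at κ = lookup v (combine i κ)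

  count : Clause n → Fin (n * 4) → ℕ
  count c j = uncurry (tally c) (remQuot {n} 4 j)

  count≤1 : ∀ c j → count c j ≤ 1
  count≤1 c j = tally≤1 c (proj₁ (remQuot {n} 4 j)) (proj₂ (remQuot {n} 4 j))

  open Counting count choose public

  choose-counters : ∀ cs i → choose (counters cs) i ≡ minimiser (λ b → litRank (i , b) cs)
  choose-counters cs i = cong₂ _≤ᵇ_ (cong₂ rank (at 0F) (at 1F)) (cong₂ rank (at 2F) (at 3F))
    where
    at : ∀ κ → lookup (counters cs) (combine i κ) ≡ ∑[ c ∈ cs ] tally c i κ
    at κ = trans (lookup-counters cs (combine i κ))
                 (∑-cong cs (λ c → cong (uncurry (tally c)) (remQuot-combine i κ)))

  space : ∀ cs → length (run algorithm cs) ≤ softOBound 12 1 n (length cs)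
  space cs = ≤-trans (length-run count≤1 cs) (space-bound n (length cs))

  assignment : List (Clause n) → Assignment n
  assignment cs = output algorithm (run algorithm cs)

  assignment-minimises-rank : ∀ cs i b → litRank (i , assignment cs i) cs ≤ litRank (i , b) cs
  assignment-minimises-rank cs i b =
    subst (λ x → litRank (i , x) cs ≤ litRank (i , b) cs) (sym chosen)
          (minimiser-≤ (λ b → litRank (i , b) cs) b)
    where
    chosen : assignment cs i ≡ minimiser (λ b → litRank (i , b) cs)
    chosen = trans (cong (λ σ → σ i) (output-run cs)) (choose-counters cs i)

  approximation : ∀ cs → FreqBounded f cs → ∀ opt → IsMinSatOpt cs opt →
                  numSat (assignment cs) cs * numSat (assignment cs) cs ≤ 4 * f * n * (opt * opt)
  approximation cs freq _ ((s , refl) , _) = bound (numSat s cs) refl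
    where
    open RankMinimising cs (assignment cs) (assignment-minimises-rank cs)
    a : ℕ
    a = numSat (assignment cs) cs
    bound : ∀ o → numSat s cs ≡ o → a * a ≤ 4 * f * n * (o * o)
    bound zero    unsat rewrite numSat≡0 s unsat = z≤n
    bound (suc o) opt≡ = begin
      a * a
        ≤⟨ square-bound {W = wide cs} {w} {N = n * f} a≤wide+w*o ([1+w]*wide≤n*f cs freq)
                        (proj₁ (⌊√⌋-spec (n * f))) (proj₂ (⌊√⌋-spec (n * f))) (s≤s z≤n) ⟩
      4 * (n * f) * (suc o * suc o)  ≡⟨ cong (_* (suc o * suc o)) (reassoc n f) ⟩
      4 * f * n * (suc o * suc o)    ∎
      where
      open ≤-Reasoning
      a≤wide+w*o : a ≤ wide cs + w * suc o
      a≤wide+w*o = subst (λ o → a ≤ wide cs + w * o) opt≡ (numSat≤wide+w*numSat s)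
      reassoc : ∀ n f → 4 * (n * f) ≡ 4 * f * n
      reassoc = solve-∀

theorem4 : Σ ℕ λ c → Σ ℕ λ k →
    Σ ((n f : ℕ) → StreamAlg n) λ alg →
      ∀ (n f : ℕ) (cs : List (Clause n)) → FreqBounded f cs →
        (length (run (alg n f) cs) ≤ softOBound c k n (length cs))
        × (∀ opt → IsMinSatOpt cs opt →
             numSat (output (alg n f) (run (alg n f) cs)) cs
               * numSat (output (alg n f) (run (alg n f) cs)) cs
             ≤ 4 * f * n * (opt * opt))
theorem4 = 12 , 1 , MinSatAlgorithm.algorithm , λ n f cs freq →
  MinSatAlgorithm.space n f cs , MinSatAlgorithm.approximation n f cs freq
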